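{- Let $G$ be a finite simple graph, $A_1,A_2$ disjoint subsets of $V(G)$, and $G^*$ the graph obtained by toggling all pairs between $A_1$ and $A_2$, with closed neighborhood matrices $N$ and $N^*$. Suppose $A_1$ and $A_2$ are NO sets in $G$ and $A_2$ is $\overline{\mathbf{x}_{A_1}}$-NO in $G$. Then for every pattern $\mathbf{p}$, $N^*\mathbf{p}=\mathbf{1}$ if and only if $N\mathbf{p}=\mathbf{1}$. Moreover, $A_1$ and $A_2$ are NO in $G^*$ and $\nu(G^*)=\nu(G)$.
   Context: For a graph $H$ with vertex set $V=\{v_1,\dots,v_n\}$, $N(H)$ is the closed neighborhood matrix over $\mathbb{Z}_2$ (entry $(i,j)$ is $1$ iff $i=j$ or $v_iv_j$ is an edge), $\nu(H)=\dim\ker N(H)$. Given disjoint $A_1,A_2\subseteq V(G)$, $G^*$ is obtained from $G$ by, for every $u\in A_1$, $v\in A_2$, adding the edge $uv$ if $u,v$ are non-adjacent and removing it if they are adjacent; $N=N(G)$, $N^*=N(G^*)$. Subsets $A$ are identified with characteristic vectors $\mathbf{x}_A$; $\mathbf{x}\cdot\mathbf{y}=\mathbf{x}^t\mathbf{y}$ over $\mathbb{Z}_2$; $\mathbf{1}$ is the all-ones vector, $\overline{\mathbf{x}}:=\mathbf{x}+\mathbf{1}$. In a graph $H$ with matrix $M$: a pattern $\mathbf{p}$ solves configuration $\mathbf{c}$ if $M\mathbf{p}=\mathbf{c}$; $\mathbf{c}$ (or a set $A$ via $\mathbf{x}_A$) is solvable if some pattern solves it; $\mathbf{1}$ is always solvable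 (odd dominating patterns exist). A set $A$ is HO if it is not solvable. For solvable $A$ and solvable $\mathbf{c}$, $A$ is $\mathbf{c}$-AO if $\mathbf{x}_A\cdot\mathbf{p}=1$ for all solving patterns $\mathbf{p}$ of $\mathbf{c}$, and $\mathbf{c}$-NO if $\mathbf{x}_A\cdot\mathbf{p}=0$ for all of them; AO and NO mean $\mathbf{1}$-AO and $\mathbf{1}$-NO. -}

module Defs where

open import Data.Bool using (Bool; true; false; _∧_; _∨_; _xor_; not)
open import Data.Nat using (ℕ; zero; suc)
open import Data.Fin using (Fin; zero; suc; _≟_)
open import Data.Product using (Σ; ∃; _×_; _,_)
open import Relation.Nullary.Decidable using (⌊_⌋)
open import Relation.Binary.PropositionalEquality using (_≡_)

-- Z₂ is represented by Bool: addition = _xor_, multiplication = _∧_.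
-- Vectors over Z₂ of length n (and vertex subsets, via characteristic
-- vectors) are functions Fin n → Bool.
Vec₂ : ℕ → Set
Vec₂ n = Fin n → Bool

Mat₂ : ℕ → Set
Mat₂ n = Fin n → Fin n → Bool

Σ₂ : ∀ {n} → (Fin n → Bool) → Bool
Σ₂ {zero} f = false
Σ₂ {suc n} f = f zero xor Σ₂ (λ i → f (suc i))

_·_ : ∀ {n} → Vec₂ n → Vec₂ n → Bool
x · y = Σ₂ (λ i → x i ∧ y i)

_*ᵥ_ : ∀ {n} → Mat₂ n → Vec₂ n → Vec₂ n
(M *ᵥ p) i = Σ₂ (λ j → M i j ∧ p j)

𝟏 : ∀ {n} → Vec₂ n
𝟏 _ = true

‾_ : ∀ {n} → Vec₂ n → Vec₂ n
(‾ x) i = x i xor true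

record Graph (n : ℕ) : Set where
  field
    adj   : Fin n → Fin n → Bool
    sym   : ∀ i j → adj i j ≡ adj j i
    irrefl : ∀ i → adj i i ≡ false
open Graph public

N : ∀ {n} → Graph n → Mat₂ n
N H i j = ⌊ i ≟ j ⌋ ∨ adj H i j

Disjoint : ∀ {n} → Vec₂ n → Vec₂ n → Set
Disjoint A₁ A₂ = ∀ i → A₁ i ∧ A₂ i ≡ false

toggle : ∀ {n} → Graph n → (A₁ A₂ : Vec₂ n) → Disjoint A₁ A₂ → Graph n
toggle {n} G A₁ A₂ d = record { adj = a ; sym = s ; irrefl = r }
  where
  cross : Fin n → Fin n → Bool
  cross i j = (A₁ i ∧ A₂ j) ∨ (A₂ i ∧ A₁ j)
  a : Fin n → Fin n → Bool
  a i j = adj G i j xor cross i j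
  s : ∀ i j → a i j ≡ a j i
  s i j rewrite sym G i j with A₁ i | A₂ i | A₁ j | A₂ j
  ... | true  | true  | true  | true  = Relation.Binary.PropositionalEquality.refl
  ... | true  | true  | true  | false = Relation.Binary.PropositionalEquality.refl
  ... | true  | true  | false | true  = Relation.Binary.PropositionalEquality.refl
  ... | true  | true  | false | false = Relation.Binary.PropositionalEquality.refl
  ... | true  | false | true  | true  = Relation.Binary.PropositionalEquality.refl
  ... | true  | false | true  | false = Relation.Binary.PropositionalEquality.refl
  ... | true  | false | false | true  = Relation.Binary.PropositionalEquality.refl
  ... | true  | false | false | false = Relation.Binary.PropositionalEquality.refl
  ... | false | true  | true  | true  = Relation.Binary.PropositionalEquality.refl
  ... | false | true  | true  | false = Relation.Binary.PropositionalEquality.refl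
  ... | false | true  | false | true  = Relation.Binary.PropositionalEquality.refl
  ... | false | true  | false | false = Relation.Binary.PropositionalEquality.refl
  ... | false | false | true  | true  = Relation.Binary.PropositionalEquality.refl
  ... | false | false | true  | false = Relation.Binary.PropositionalEquality.refl
  ... | false | false | false | true  = Relation.Binary.PropositionalEquality.refl
  ... | false | false | false | false = Relation.Binary.PropositionalEquality.refl
  r : ∀ i → a i i ≡ false
  r i rewrite irrefl G i with A₁ i | A₂ i | d i
  ... | true  | true  | ()
  ... | true  | false | _ = Relation.Binary.PropositionalEquality.refl
  ... | false | true  | _ = Relation.Binary.PropositionalEquality.refl
  ... | false | false | _ = Relation.Binary.PropositionalEquality.refl

Solves : ∀ {n} → Graph n → Vec₂ n → Vec₂ n → Set
Solves H p c = ∀ i → (N H *ᵥ p) i ≡ c i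

Solvable : ∀ {n} → Graph n → Vec₂ n → Set
Solvable H c = ∃ λ p → Solves H p c

IsCNO : ∀ {n} → Graph n → (c A : Vec₂ n) → Set
IsCNO H c A = Solvable H A × Solvable H c × (∀ p → Solves H p c → A · p ≡ false)

IsNO : ∀ {n} → Graph n → Vec₂ n → Set
IsNO H A = IsCNO H 𝟏 A

InKer : ∀ {n} → Mat₂ n → Vec₂ n → Set
InKer M v = ∀ i → (M *ᵥ v) i ≡ false

lincomb : ∀ {n k} → (Fin k → Vec₂ n) → (Fin k → Bool) → Vec₂ n
lincomb b λs i = Σ₂ (λ j → λs j ∧ b j i)

KerDim : ∀ {n} → Mat₂ n → ℕ → Set
KerDim {n} M k = Σ (Fin k → Vec₂ n) λ b →
    (∀ j → InKer M (b j))
  × (∀ λs → (∀ i → lincomb b λs i ≡ false) → ∀ j → λs j ≡ false)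
  × (∀ v → InKer M v → ∃ λ λs → ∀ i → v i ≡ lincomb b λs i)

ν≡ : ∀ {n} → Graph n → ℕ → Set
ν≡ H k = KerDim (N H) k

-- Toggling the A₁–A₂ pairs changes the closed neighbourhood matrix by the rank-two
-- term A₁A₂ᵗ + A₂A₁ᵗ, so N* p = N p whenever p is orthogonal to A₁ and A₂.
-- If s₁, s₂ solve A₁, A₂ and both are orthogonal to A₁ and A₂, then s₁, s₂ still
-- solve A₁, A₂ in G*, and since N and N* are symmetric, in either graph any p with
-- N p = c (resp. N* p = c) has Aᵢ · p = sᵢ · c. So G and G* have the same solutions
-- of every configuration c orthogonal to s₁ and s₂, in particular of 𝟏 and of 0.
-- The hypotheses give the required orthogonalities: xᵗ N x = 𝟏 · x turns the NO
-- property into Aᵢ · sᵢ = 0, and s₁ + q solves 𝟏 + A₁ for any odd dominating q.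
module Submission where

open import Algebra.Bundles using (CommutativeRing)
open import Data.Bool using (Bool; true; false; _∧_; _∨_; _xor_)
open import Data.Bool.Properties
  using (xor-∧-commutativeRing; xor-assoc; xor-same; xor-identityʳ; ∨-identityʳ;
         ∧-distribˡ-xor; ∧-distribʳ-xor; ∧-comm; ∧-assoc; ∧-idem; ∧-zeroʳ)
open import Data.Fin using (Fin; zero; suc; _≟_)
open import Data.Nat using (zero; suc)
open import Data.Product using (_×_; _,_; proj₁; proj₂)
open import Function.Bundles using (_⇔_; mk⇔; Equivalence)
open import Relation.Binary.PropositionalEquality
open import Relation.Nullary using (yes; no; contradiction)
open import Defs hiding (sym)

open import Algebra.Properties.CommutativeSemigroup
  (CommutativeRing.+-commutativeSemigroup xor-∧-commutativeRing) using (interchange)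
open import Algebra.Properties.CommutativeSemigroup
  (CommutativeRing.*-commutativeSemigroup xor-∧-commutativeRing)
  using (xy∙z≈y∙xz; x∙yz≈y∙xz; x∙yz≈z∙yx)

open Equivalence using (to; from)
open ≡-Reasoning

infixl 6 _⊕_

_⊕_ : ∀ {n} → Vec₂ n → Vec₂ n → Vec₂ n
(x ⊕ y) i = x i xor y i

Σ₂-cong : ∀ {n} {f g : Fin n → Bool} → (∀ i → f i ≡ g i) → Σ₂ f ≡ Σ₂ g
Σ₂-cong {zero}  f≡g = refl
Σ₂-cong {suc n} f≡g = cong₂ _xor_ (f≡g zero) (Σ₂-cong (λ i → f≡g (suc i)))

Σ₂-zero : ∀ n → Σ₂ {n} (λ _ → false) ≡ false
Σ₂-zero zero    = refl
Σ₂-zero (suc n) = Σ₂-zero n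

Σ₂-xor : ∀ {n} (f g : Fin n → Bool) → Σ₂ (λ i → f i xor g i) ≡ Σ₂ f xor Σ₂ g
Σ₂-xor {zero}  f g = refl
Σ₂-xor {suc n} f g = begin
  (f zero xor g zero) xor Σ₂ (λ i → f (suc i) xor g (suc i))
    ≡⟨ cong ((f zero xor g zero) xor_) (Σ₂-xor (λ i → f (suc i)) (λ i → g (suc i))) ⟩
  (f zero xor g zero) xor (Σ₂ (λ i → f (suc i)) xor Σ₂ (λ i → g (suc i)))
    ≡⟨ interchange (f zero) (g zero) _ _ ⟩
  Σ₂ f xor Σ₂ g ∎

Σ₂-∧ˡ : ∀ {n} a (f : Fin n → Bool) → Σ₂ (λ i → a ∧ f i) ≡ a ∧ Σ₂ f
Σ₂-∧ˡ {zero}  a f = sym (∧-zeroʳ a)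
Σ₂-∧ˡ {suc n} a f = begin
  (a ∧ f zero) xor Σ₂ (λ i → a ∧ f (suc i))
    ≡⟨ cong ((a ∧ f zero) xor_) (Σ₂-∧ˡ a (λ i → f (suc i))) ⟩
  (a ∧ f zero) xor (a ∧ Σ₂ (λ i → f (suc i)))
    ≡⟨ sym (∧-distribˡ-xor a (f zero) _) ⟩
  a ∧ Σ₂ f ∎

Σ₂-∧ʳ : ∀ {n} a (f : Fin n → Bool) → Σ₂ (λ i → f i ∧ a) ≡ Σ₂ f ∧ a
Σ₂-∧ʳ a f = begin
  Σ₂ (λ i → f i ∧ a) ≡⟨ Σ₂-cong (λ i → ∧-comm (f i) a) ⟩
  Σ₂ (λ i → a ∧ f i) ≡⟨ Σ₂-∧ˡ a f ⟩
  a ∧ Σ₂ f           ≡⟨ ∧-comm a _ ⟩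
  Σ₂ f ∧ a           ∎

Σ₂-swap : ∀ {m n} (f : Fin m → Fin n → Bool) →
  Σ₂ (λ i → Σ₂ (f i)) ≡ Σ₂ (λ j → Σ₂ (λ i → f i j))
Σ₂-swap {zero}  {n} f = sym (Σ₂-zero n)
Σ₂-swap {suc m}     f = begin
  Σ₂ (f zero) xor Σ₂ (λ i → Σ₂ (f (suc i)))
    ≡⟨ cong (Σ₂ (f zero) xor_) (Σ₂-swap (λ i → f (suc i))) ⟩
  Σ₂ (f zero) xor Σ₂ (λ j → Σ₂ (λ i → f (suc i) j))
    ≡⟨ sym (Σ₂-xor (f zero) _) ⟩
  Σ₂ (λ j → Σ₂ (λ i → f i j)) ∎

-- The off-diagonal terms f i j and f j i cancel in pairs over Z₂.
Σ₂-diagonal : ∀ {n} (f : Fin n → Fin n → Bool) → (∀ i j → f i j ≡ f j i) →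
  Σ₂ (λ i → Σ₂ (f i)) ≡ Σ₂ (λ i → f i i)
Σ₂-diagonal {zero}  f f-sym = refl
Σ₂-diagonal {suc n} f f-sym = begin
  (f zero zero xor row) xor Σ₂ (λ i → f (suc i) zero xor Σ₂ (λ j → f (suc i) (suc j)))
    ≡⟨ cong ((f zero zero xor row) xor_) (Σ₂-xor (λ i → f (suc i) zero) _) ⟩
  (f zero zero xor row) xor (Σ₂ (λ i → f (suc i) zero) xor Σ₂ (λ i → Σ₂ (λ j → f (suc i) (suc j))))
    ≡⟨ cong₂ (λ c r → (f zero zero xor row) xor (c xor r))
         (Σ₂-cong (λ i → f-sym (suc i) zero))
         (Σ₂-diagonal (λ i j → f (suc i) (suc j)) (λ i j → f-sym (suc i) (suc j))) ⟩
  (f zero zero xor row) xor (row xor rest)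
    ≡⟨ xor-assoc (f zero zero) row _ ⟩
  f zero zero xor (row xor (row xor rest))
    ≡⟨ cong (f zero zero xor_) (sym (xor-assoc row row rest)) ⟩
  f zero zero xor ((row xor row) xor rest)
    ≡⟨ cong (λ b → f zero zero xor (b xor rest)) (xor-same row) ⟩
  f zero zero xor rest ∎
  where
  row  = Σ₂ (λ j → f zero (suc j))
  rest = Σ₂ (λ i → f (suc i) (suc i))

·-comm : ∀ {n} (x y : Vec₂ n) → x · y ≡ y · x
·-comm x y = Σ₂-cong (λ i → ∧-comm (x i) (y i))

·-congʳ : ∀ {n} (x : Vec₂ n) {y z : Vec₂ n} → (∀ i → y i ≡ z i) → x · y ≡ x · z
·-congʳ x y≡z = Σ₂-cong (λ i → cong (x i ∧_) (y≡z i))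

·-zeroʳ : ∀ {n} (x : Vec₂ n) → x · (λ _ → false) ≡ false
·-zeroʳ {n} x = trans (Σ₂-cong (λ i → ∧-zeroʳ (x i))) (Σ₂-zero n)

·-distribˡ-⊕ : ∀ {n} (x y z : Vec₂ n) → x · (y ⊕ z) ≡ x · y xor x · z
·-distribˡ-⊕ x y z =
  trans (Σ₂-cong (λ i → ∧-distribˡ-xor (x i) (y i) (z i)))
        (Σ₂-xor (λ i → x i ∧ y i) (λ i → x i ∧ z i))

Symmetric : ∀ {n} → Mat₂ n → Set
Symmetric M = ∀ i j → M i j ≡ M j i

*ᵥ-cong : ∀ {n} {M M′ : Mat₂ n} → (∀ i j → M i j ≡ M′ i j) →
  ∀ p i → (M *ᵥ p) i ≡ (M′ *ᵥ p) i
*ᵥ-cong M≡M′ p i = Σ₂-cong (λ j → cong (_∧ p j) (M≡M′ i j))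

*ᵥ-distribˡ-⊕ : ∀ {n} (M : Mat₂ n) (x y : Vec₂ n) i →
  (M *ᵥ (x ⊕ y)) i ≡ (M *ᵥ x) i xor (M *ᵥ y) i
*ᵥ-distribˡ-⊕ M x y i = ·-distribˡ-⊕ (M i) x y

*ᵥ-distribʳ-⊕ : ∀ {n} (M M′ : Mat₂ n) (p : Vec₂ n) i →
  ((λ i j → M i j xor M′ i j) *ᵥ p) i ≡ (M *ᵥ p) i xor (M′ *ᵥ p) i
*ᵥ-distribʳ-⊕ M M′ p i =
  trans (Σ₂-cong (λ j → ∧-distribʳ-xor (p j) (M i j) (M′ i j)))
        (Σ₂-xor (λ j → M i j ∧ p j) (λ j → M′ i j ∧ p j))

*ᵥ-outer : ∀ {n} (u v p : Vec₂ n) i → ((λ i j → u i ∧ v j) *ᵥ p) i ≡ u i ∧ (v · p)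
*ᵥ-outer u v p i = trans (Σ₂-cong (λ j → ∧-assoc (u i) (v j) (p j))) (Σ₂-∧ˡ (u i) (λ j → v j ∧ p j))

*ᵥ-adjoint : ∀ {n} {M : Mat₂ n} → Symmetric M → ∀ x y → (M *ᵥ x) · y ≡ x · (M *ᵥ y)
*ᵥ-adjoint {M = M} M-sym x y = begin
  Σ₂ (λ i → (M *ᵥ x) i ∧ y i)
    ≡⟨ Σ₂-cong (λ i → sym (Σ₂-∧ʳ (y i) (λ j → M i j ∧ x j))) ⟩
  Σ₂ (λ i → Σ₂ (λ j → (M i j ∧ x j) ∧ y i))
    ≡⟨ Σ₂-swap (λ i j → (M i j ∧ x j) ∧ y i) ⟩
  Σ₂ (λ j → Σ₂ (λ i → (M i j ∧ x j) ∧ y i))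
    ≡⟨ Σ₂-cong (λ j → Σ₂-cong (λ i →
         trans (cong (λ m → (m ∧ x j) ∧ y i) (M-sym i j)) (xy∙z≈y∙xz (M j i) (x j) (y i)))) ⟩
  Σ₂ (λ j → Σ₂ (λ i → x j ∧ (M j i ∧ y i)))
    ≡⟨ Σ₂-cong (λ j → Σ₂-∧ˡ (x j) (λ i → M j i ∧ y i)) ⟩
  x · (M *ᵥ y) ∎

*ᵥ-quadratic : ∀ {n} {M : Mat₂ n} → Symmetric M → ∀ x → x · (M *ᵥ x) ≡ Σ₂ (λ i → M i i ∧ x i)
*ᵥ-quadratic {M = M} M-sym x = begin
  Σ₂ (λ i → x i ∧ (M *ᵥ x) i)
    ≡⟨ Σ₂-cong (λ i → sym (Σ₂-∧ˡ (x i) (λ j → M i j ∧ x j))) ⟩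
  Σ₂ (λ i → Σ₂ (λ j → x i ∧ (M i j ∧ x j)))
    ≡⟨ Σ₂-diagonal _ (λ i j →
         trans (cong (λ m → x i ∧ (m ∧ x j)) (M-sym i j)) (x∙yz≈z∙yx (x i) (M j i) (x j))) ⟩
  Σ₂ (λ i → x i ∧ (M i i ∧ x i))
    ≡⟨ Σ₂-cong (λ i → trans (x∙yz≈y∙xz (x i) (M i i) (x i)) (cong (M i i ∧_) (∧-idem (x i)))) ⟩
  Σ₂ (λ i → M i i ∧ x i) ∎

N-symmetric : ∀ {n} (H : Graph n) → Symmetric (N H)
N-symmetric H i j with i ≟ j | j ≟ i
... | yes _    | yes _   = refl
... | yes refl | no i≢i  = contradiction refl i≢i
... | no i≢i   | yes refl = contradiction refl i≢i
... | no _     | no _    = Graph.sym H i j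

N-diagonal : ∀ {n} (H : Graph n) i → N H i i ≡ true
N-diagonal H i with i ≟ i
... | yes _   = refl
... | no i≢i  = contradiction refl i≢i

solves-⊕ : ∀ {n} (H : Graph n) {p p′ c c′ : Vec₂ n} →
  Solves H p c → Solves H p′ c′ → Solves H (p ⊕ p′) (c ⊕ c′)
solves-⊕ H {p} {p′} Np≡c Np′≡c′ i =
  trans (*ᵥ-distribˡ-⊕ (N H) p p′ i) (cong₂ _xor_ (Np≡c i) (Np′≡c′ i))

solves-·-exchange : ∀ {n} (H : Graph n) {s a p c : Vec₂ n} →
  Solves H s a → Solves H p c → a · p ≡ s · c
solves-·-exchange H {s} {a} {p} {c} Ns≡a Np≡c = begin
  a · p           ≡⟨ Σ₂-cong (λ i → cong (_∧ p i) (sym (Ns≡a i))) ⟩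
  (N H *ᵥ s) · p  ≡⟨ *ᵥ-adjoint (N-symmetric H) s p ⟩
  s · (N H *ᵥ p)  ≡⟨ ·-congʳ s Np≡c ⟩
  s · c           ∎

solves-·-self : ∀ {n} (H : Graph n) {s a q : Vec₂ n} →
  Solves H s a → Solves H q 𝟏 → a · s ≡ a · q
solves-·-self H {s} {a} {q} Ns≡a Nq≡𝟏 = begin
  a · s                          ≡⟨ ·-comm a s ⟩
  s · a                          ≡⟨ ·-congʳ s (λ i → sym (Ns≡a i)) ⟩
  s · (N H *ᵥ s)                 ≡⟨ *ᵥ-quadratic (N-symmetric H) s ⟩
  Σ₂ (λ i → N H i i ∧ s i)       ≡⟨ Σ₂-cong (λ i → cong (_∧ s i) (N-diagonal H i)) ⟩
  𝟏 · s                          ≡⟨ solves-·-exchange H Nq≡𝟏 Ns≡a ⟩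
  q · a                          ≡⟨ ·-comm q a ⟩
  a · q                          ∎

∧∨∧≡∧xor∧ : ∀ a₁ a₂ b₁ b₂ → a₁ ∧ a₂ ≡ false →
  (a₁ ∧ b₂) ∨ (a₂ ∧ b₁) ≡ (a₁ ∧ b₂) xor (a₂ ∧ b₁)
∧∨∧≡∧xor∧ true  true  b₁ b₂ ()
∧∨∧≡∧xor∧ true  false b₁ b₂ _ = trans (∨-identityʳ b₂) (sym (xor-identityʳ b₂))
∧∨∧≡∧xor∧ false a₂    b₁ b₂ _ = refl

KerDim-resp : ∀ {n} {P Q : Mat₂ n} → (∀ v → InKer P v ⇔ InKer Q v) →
  ∀ k → KerDim P k ⇔ KerDim Q k
KerDim-resp ker⇔ k =
  mk⇔ (transport (λ v → to (ker⇔ v)) (λ v → from (ker⇔ v)))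
      (transport (λ v → from (ker⇔ v)) (λ v → to (ker⇔ v)))
  where
  transport : ∀ {P Q} → (∀ v → InKer P v → InKer Q v) → (∀ v → InKer Q v → InKer P v) →
    KerDim P k → KerDim Q k
  transport P⊆Q Q⊆P (b , b∈ker , independent , spanning) =
    b , (λ j → P⊆Q (b j) (b∈ker j)) , independent , (λ v v∈Q → spanning v (Q⊆P v v∈Q))

module Toggle {n} (G : Graph n) (A₁ A₂ : Vec₂ n) (d : Disjoint A₁ A₂) where

  G* : Graph n
  G* = toggle G A₁ A₂ d

  Orthogonal : Vec₂ n → Set
  Orthogonal p = A₁ · p ≡ false × A₂ · p ≡ false

  N-toggle : ∀ i j → N G* i j ≡ N G i j xor ((A₁ i ∧ A₂ j) xor (A₂ i ∧ A₁ j))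
  N-toggle i j with i ≟ j
  N-toggle i .i | yes refl =
    cong (true xor_) (sym (cong₂ _xor_ (d i) (trans (∧-comm (A₂ i) (A₁ i)) (d i))))
  N-toggle i j  | no _ =
    cong (adj G i j xor_) (∧∨∧≡∧xor∧ (A₁ i) (A₂ i) (A₁ j) (A₂ j) (d i))

  N-toggle-*ᵥ : ∀ p i →
    (N G* *ᵥ p) i ≡ (N G *ᵥ p) i xor ((A₁ i ∧ A₂ · p) xor (A₂ i ∧ A₁ · p))
  N-toggle-*ᵥ p i = begin
    (N G* *ᵥ p) i
      ≡⟨ *ᵥ-cong N-toggle p i ⟩
    ((λ i j → N G i j xor ((A₁ i ∧ A₂ j) xor (A₂ i ∧ A₁ j))) *ᵥ p) i
      ≡⟨ *ᵥ-distribʳ-⊕ (N G) (λ i j → (A₁ i ∧ A₂ j) xor (A₂ i ∧ A₁ j)) p i ⟩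
    (N G *ᵥ p) i xor ((λ i j → (A₁ i ∧ A₂ j) xor (A₂ i ∧ A₁ j)) *ᵥ p) i
      ≡⟨ cong ((N G *ᵥ p) i xor_) (*ᵥ-distribʳ-⊕ (λ i j → A₁ i ∧ A₂ j) (λ i j → A₂ i ∧ A₁ j) p i) ⟩
    (N G *ᵥ p) i xor (((λ i j → A₁ i ∧ A₂ j) *ᵥ p) i xor ((λ i j → A₂ i ∧ A₁ j) *ᵥ p) i)
      ≡⟨ cong ((N G *ᵥ p) i xor_) (cong₂ _xor_ (*ᵥ-outer A₁ A₂ p i) (*ᵥ-outer A₂ A₁ p i)) ⟩
    (N G *ᵥ p) i xor ((A₁ i ∧ A₂ · p) xor (A₂ i ∧ A₁ · p)) ∎

  N-toggle-*ᵥ-orthogonal : ∀ {p} → Orthogonal p → ∀ i → (N G* *ᵥ p) i ≡ (N G *ᵥ p) i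
  N-toggle-*ᵥ-orthogonal {p} (A₁·p≡0 , A₂·p≡0) i = begin
    (N G* *ᵥ p) i
      ≡⟨ N-toggle-*ᵥ p i ⟩
    (N G *ᵥ p) i xor ((A₁ i ∧ A₂ · p) xor (A₂ i ∧ A₁ · p))
      ≡⟨ cong₂ (λ a b → (N G *ᵥ p) i xor ((A₁ i ∧ a) xor (A₂ i ∧ b))) A₂·p≡0 A₁·p≡0 ⟩
    (N G *ᵥ p) i xor ((A₁ i ∧ false) xor (A₂ i ∧ false))
      ≡⟨ cong ((N G *ᵥ p) i xor_) (cong₂ _xor_ (∧-zeroʳ (A₁ i)) (∧-zeroʳ (A₂ i))) ⟩
    (N G *ᵥ p) i xor false
      ≡⟨ xor-identityʳ _ ⟩
    (N G *ᵥ p) i ∎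

  solves-toggle⇔-orthogonal : ∀ {p c} → Orthogonal p → Solves G* p c ⇔ Solves G p c
  solves-toggle⇔-orthogonal p⊥ =
    mk⇔ (λ N*p≡c i → trans (sym (N-toggle-*ᵥ-orthogonal p⊥ i)) (N*p≡c i))
        (λ Np≡c i → trans (N-toggle-*ᵥ-orthogonal p⊥ i) (Np≡c i))

  -- The last hypothesis is where A₂ being 𝟏 + A₁-NO enters: s₁ + q solves 𝟏 + A₁.
  solutions-orthogonal : ∀ {s₁ s₂ q} → Solves G s₁ A₁ → Solves G s₂ A₂ → Solves G q 𝟏 →
    Orthogonal q → A₂ · (s₁ ⊕ q) ≡ false → Orthogonal s₁ × Orthogonal s₂
  solutions-orthogonal {s₁} {s₂} {q} Ns₁≡A₁ Ns₂≡A₂ Nq≡𝟏 (A₁·q≡0 , A₂·q≡0) A₂·[s₁⊕q]≡0 =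
    (trans (solves-·-self G Ns₁≡A₁ Nq≡𝟏) A₁·q≡0 , A₂·s₁≡0) ,
    (trans (solves-·-exchange G Ns₁≡A₁ Ns₂≡A₂) (trans (·-comm s₁ A₂) A₂·s₁≡0) ,
     trans (solves-·-self G Ns₂≡A₂ Nq≡𝟏) A₂·q≡0)
    where
    A₂·s₁≡0 : A₂ · s₁ ≡ false
    A₂·s₁≡0 = begin
      A₂ · s₁             ≡⟨ sym (xor-identityʳ _) ⟩
      A₂ · s₁ xor false   ≡⟨ cong (A₂ · s₁ xor_) (sym A₂·q≡0) ⟩
      A₂ · s₁ xor A₂ · q  ≡⟨ sym (·-distribˡ-⊕ A₂ s₁ q) ⟩
      A₂ · (s₁ ⊕ q)       ≡⟨ A₂·[s₁⊕q]≡0 ⟩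
      false               ∎

  solves-toggle⇔ : ∀ {s₁ s₂ c} → Solves G s₁ A₁ → Solves G s₂ A₂ →
    Orthogonal s₁ → Orthogonal s₂ → s₁ · c ≡ false → s₂ · c ≡ false →
    ∀ p → Solves G* p c ⇔ Solves G p c
  solves-toggle⇔ {s₁} {s₂} {c} Ns₁≡A₁ Ns₂≡A₂ s₁⊥ s₂⊥ s₁·c≡0 s₂·c≡0 p =
    mk⇔ (λ N*p≡c → to (solves-toggle⇔-orthogonal (orthogonal G* N*s₁≡A₁ N*s₂≡A₂ N*p≡c)) N*p≡c)
        (λ Np≡c → from (solves-toggle⇔-orthogonal (orthogonal G Ns₁≡A₁ Ns₂≡A₂ Np≡c)) Np≡c)
    where
    N*s₁≡A₁ = from (solves-toggle⇔-orthogonal s₁⊥) Ns₁≡A₁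
    N*s₂≡A₂ = from (solves-toggle⇔-orthogonal s₂⊥) Ns₂≡A₂
    orthogonal : ∀ H → Solves H s₁ A₁ → Solves H s₂ A₂ → Solves H p c →
      Orthogonal p
    orthogonal H hs₁ hs₂ hp =
      trans (solves-·-exchange H hs₁ hp) s₁·c≡0 , trans (solves-·-exchange H hs₂ hp) s₂·c≡0

mainTheorem9 : ∀ {n} (G : Graph n) (A₁ A₂ : Vec₂ n) (d : Disjoint A₁ A₂)
    → IsNO G A₁ → IsNO G A₂ → IsCNO G (‾ A₁) A₂
    → (∀ p → Solves (toggle G A₁ A₂ d) p 𝟏 ⇔ Solves G p 𝟏)
      × IsNO (toggle G A₁ A₂ d) A₁
      × IsNO (toggle G A₁ A₂ d) A₂
      × (∀ k → ν≡ (toggle G A₁ A₂ d) k ⇔ ν≡ G k)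
mainTheorem9 G A₁ A₂ d ((s₁ , Ns₁≡A₁) , (q , Nq≡𝟏) , A₁-NO) ((s₂ , Ns₂≡A₂) , _ , A₂-NO)
             (_ , _ , A₂-A̅₁-NO) =
  solves𝟏⇔ , NO-toggle Ns₁≡A₁ s₁⊥ A₁-NO , NO-toggle Ns₂≡A₂ s₂⊥ A₂-NO ,
  KerDim-resp (transfer (·-zeroʳ s₁) (·-zeroʳ s₂))
  where
  open Toggle G A₁ A₂ d

  q⊥ : Orthogonal q
  q⊥ = A₁-NO q Nq≡𝟏 , A₂-NO q Nq≡𝟏

  s₁⊥,s₂⊥ : Orthogonal s₁ × Orthogonal s₂
  s₁⊥,s₂⊥ = solutions-orthogonal Ns₁≡A₁ Ns₂≡A₂ Nq≡𝟏 q⊥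
              (A₂-A̅₁-NO (s₁ ⊕ q) (solves-⊕ G Ns₁≡A₁ Nq≡𝟏))
  s₁⊥ : Orthogonal s₁
  s₁⊥ = proj₁ s₁⊥,s₂⊥

  s₂⊥ : Orthogonal s₂
  s₂⊥ = proj₂ s₁⊥,s₂⊥

  transfer : ∀ {c} → s₁ · c ≡ false → s₂ · c ≡ false → ∀ p → Solves G* p c ⇔ Solves G p c
  transfer = solves-toggle⇔ Ns₁≡A₁ Ns₂≡A₂ s₁⊥ s₂⊥

  solves𝟏⇔ : ∀ p → Solves G* p 𝟏 ⇔ Solves G p 𝟏
  solves𝟏⇔ = transfer (trans (sym (solves-·-exchange G Ns₁≡A₁ Nq≡𝟏)) (proj₁ q⊥))
                      (trans (sym (solves-·-exchange G Ns₂≡A₂ Nq≡𝟏)) (proj₂ q⊥))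

  NO-toggle : ∀ {s A} → Solves G s A → Orthogonal s →
    (∀ p → Solves G p 𝟏 → A · p ≡ false) → IsNO G* A
  NO-toggle Ns≡A s⊥ A-NO =
    (_ , from (solves-toggle⇔-orthogonal s⊥) Ns≡A) ,
    (q , from (solves𝟏⇔ q) Nq≡𝟏) ,
    (λ p N*p≡𝟏 → A-NO p (to (solves𝟏⇔ p) N*p≡𝟏))
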